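{- Let $G$ be a graph and let $g,k,\lambda$ be integers. For a vertex $w$, let $cyc(G,g,w)$ denote the number of cycles of length $g$ in $G$ containing $w$, and let $N_G(w)$ denote the set of neighbours of $w$ in $G$. Suppose there is a vertex $u\in V(G)$ of degree $k$ in $G$ such that either $$(k-2)\lambda+2\,cyc(G,g,u)-\sum_{u'\in N_G(u)}cyc(G,g,u')<0,$$ or simultaneously $$(2-k)\lambda+\sum_{u'\in N_G(u)}cyc(G,g,u')-2\max_{u'\in N_G(u)}cyc(G,g,u')\geq 0$$ and $$(k-2)\lambda+cyc(G,g,u)-\sum_{u'\in N_G(u)}cyc(G,g,u')+\max_{u'\in N_G(u)}cyc(G,g,u')<0.$$ Then $G$ does not occur as a subgraph of any $vgr(v,k,g,\lambda)$-graph (for any $v$).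
   Context: A $vgr(v,k,g,\lambda)$-graph is a $k$-regular graph of girth $g$ on $v$ vertices in which every vertex is contained in exactly $\lambda$ cycles of length $g$. -}

module Defs where

open import Data.Bool using (Bool; true; false; _∧_; not; if_then_else_)
open import Data.Nat using (ℕ; zero; suc; _∸_; _<ᵇ_; _≤ᵇ_; _⊔_; _<_)
open import Data.Fin using (Fin; toℕ; _≟_)
open import Data.List using (List; []; _∷_; [_]; _++_; map; concatMap; allFin; length; filterᵇ; foldr)
open import Data.Nat.ListAction using (sum)
open import Data.Empty using (⊥)
open import Data.Vec using (Vec; toList) renaming ([] to []ᵛ; _∷_ to _∷ᵛ_)
open import Data.Product using (Σ; ∃; _×_; _,_)
open import Relation.Binary.PropositionalEquality using (_≡_)
open import Relation.Nullary.Decidable using (⌊_⌋)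
open import Function.Definitions using (Injective)

record Graph (n : ℕ) : Set where
  field
    adj    : Fin n → Fin n → Bool
    sym    : ∀ x y → adj x y ≡ adj y x
    irrefl : ∀ x → adj x x ≡ false
open Graph public

module _ {n : ℕ} (G : Graph n) where

  neighbours : Fin n → List (Fin n)
  neighbours w = filterᵇ (adj G w) (allFin n)

  deg : Fin n → ℕ
  deg w = length (neighbours w)

  pathAdj : List (Fin n) → Bool
  pathAdj (x ∷ y ∷ r) = adj G x y ∧ pathAdj (y ∷ r)
  pathAdj _ = true

  closedAdj : List (Fin n) → Bool
  closedAdj [] = true
  closedAdj (x ∷ r) = pathAdj ((x ∷ r) ++ [ x ])

  elem : Fin n → List (Fin n) → Bool
  elem x [] = false
  elem x (y ∷ r) = if ⌊ x ≟ y ⌋ then true else elem x r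

  distinct : List (Fin n) → Bool
  distinct [] = true
  distinct (x ∷ r) = not (elem x r) ∧ distinct r

  lastOr : Fin n → List (Fin n) → Fin n
  lastOr y [] = y
  lastOr _ (z ∷ r) = lastOr z r

  -- orientation normalisation: the second vertex is smaller than the last
  canonical : List (Fin n) → Bool
  canonical [] = false
  canonical (y ∷ r) = toℕ y <ᵇ toℕ (lastOr y r)

  allVecs : (m : ℕ) → List (Vec (Fin n) m)
  allVecs zero = []ᵛ ∷ []
  allVecs (suc m) = concatMap (λ x → map (x ∷ᵛ_) (allVecs m)) (allFin n)

  -- Every cycle of length g through w has exactly one such representative
  -- (start at w, choose the orientation with the smaller second vertex).
  isRepCycle : (g : ℕ) → Fin n → Vec (Fin n) (g ∸ 1) → Bool
  isRepCycle g w t =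
    (3 ≤ᵇ g) ∧ distinct (w ∷ toList t) ∧ closedAdj (w ∷ toList t) ∧ canonical (toList t)

  cyc : ℕ → Fin n → ℕ
  cyc g w = length (filterᵇ (isRepCycle g w) (allVecs (g ∸ 1)))

  HasCycle : ℕ → Set
  HasCycle g = ∃ λ w → 0 < cyc g w

  -- sum and maximum of cyc(G,g,u') over u' ∈ N_G(u) (max of empty set := 0)
  sumNbrCyc : ℕ → Fin n → ℕ
  sumNbrCyc g u = sum (map (cyc g) (neighbours u))

  maxNbrCyc : ℕ → Fin n → ℕ
  maxNbrCyc g u = foldr _⊔_ 0 (map (cyc g) (neighbours u))

Regular : ∀ {n} → Graph n → ℕ → Set
Regular G k = ∀ x → deg G x ≡ k

Girth : ∀ {n} → Graph n → ℕ → Set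
Girth G g = HasCycle G g × (∀ m → m < g → HasCycle G m → ⊥)

IsVGR : (v k g lam : ℕ) → Graph v → Set
IsVGR v k g lam H = Regular H k × Girth H g × (∀ x → cyc H g x ≡ lam)

-- G occurs as a (not necessarily induced) subgraph of H
SubgraphOf : ∀ {m v} → Graph m → Graph v → Set
SubgraphOf {m} {v} G H =
  Σ (Fin m → Fin v) λ f → Injective _≡_ _≡_ f ×
    (∀ x y → adj G x y ≡ true → adj H (f x) (f y) ≡ true)

{-# OPTIONS --safe #-}
-- Count the g-cycles through a vertex w as rooted cycles w x₁ … x_{g-1}: each cycle through w
-- gives two of them, one per orientation, and the cycles through an edge wy correspond to the
-- rooted cycles at w with x₁ = y. Their number e(w, y) is symmetric in w and y and sums to
-- 2 cyc(w) over the neighbours y of w. Rooted cycles at z avoiding the edge zy are sent by the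
-- embedding f to rooted cycles at f z in H avoiding the edge f z f y, whence
-- cyc_G(z) + e_H(f z, f y) ≤ e_G(z, y) + λ. Since u has degree k in both graphs, f maps N_G(u)
-- onto N_H(f u). Summing over z ∈ N_G(u) with y = u gives Σ cyc(u') + 2λ ≤ kλ + 2 cyc(u); using
-- instead, for one neighbour y, the inequality at u for the edge uy in place of its summand gives
-- Σ cyc(u') + 2λ ≤ kλ + cyc(u) + cyc(y). Each contradicts one of the two hypotheses.
module Submission where

module Counting where

  open import Data.Bool using (Bool; true; false; T; _∧_; not)
  open import Data.Bool.Properties using (T-∧)
  open import Data.Empty using (⊥; ⊥-elim)
  open import Data.List using (List; []; _∷_; [_]; _++_; map; length; filterᵇ; foldr)
  open import Data.List.Properties using (length-++-sucʳ; map-cong-local; filter-none)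
  open import Data.List.Membership.Propositional using (_∈_)
  open import Data.List.Membership.Propositional.Properties using (∈-∃++; ∈-filter⁺; ∈-filter⁻)
  open import Data.List.Relation.Unary.All as All using (All; []; _∷_)
  open import Data.List.Relation.Unary.Any using (here; there)
  open import Data.List.Relation.Unary.Unique.Propositional using (Unique; []; _∷_)
  import Data.List.Relation.Unary.Unique.Propositional.Properties as Unique
  open import Data.Nat using (ℕ; suc; _+_; _*_; _≤_; _⊔_; z≤n; s≤s)
  open import Data.Nat.ListAction using (sum)
  open import Data.Nat.Properties
    using (+-suc; +-comm; +-assoc; +-identityʳ; +-mono-≤; +-monoˡ-≤; +-monoʳ-≤; +-cancelˡ-≤; ≤-trans; 1+n≰n; m≤m⊔n;
           +-commutativeSemigroup; module ≤-Reasoning)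
  open import Algebra.Properties.CommutativeSemigroup +-commutativeSemigroup
    using (interchange; x∙yz≈y∙xz; x∙yz≈xz∙y; xy∙z≈xz∙y; xy∙z≈yz∙x)
  open import Data.Product using (∃-syntax; _×_; _,_; proj₁; proj₂)
  open import Function using (_∘_; id; case_of_)
  open import Function.Bundles using (Equivalence)
  open import Relation.Binary.Definitions using (DecidableEquality)
  open import Relation.Binary.PropositionalEquality using (_≡_; _≢_; refl; sym; trans; cong; subst; module ≡-Reasoning)
  open import Relation.Nullary using (yes; no; contradiction)
  open import Relation.Nullary.Decidable using (⌊_⌋; T?; toWitness; dec-true; isYes≗does)

  open Equivalence using (to)

  count : {A : Set} → (A → Bool) → List A → ℕ
  count p xs = length (filterᵇ p xs)

  ∧-congˡ-T : ∀ {a b c} → (T a → b ≡ c) → a ∧ b ≡ a ∧ c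
  ∧-congˡ-T {true}  b≡c = b≡c _
  ∧-congˡ-T {false} _   = refl

  ∧-not-redundant : ∀ a b c → (T a → T c → T b → ⊥) → a ∧ c ≡ (a ∧ not b) ∧ c
  ∧-not-redundant true  true  true  absurd = ⊥-elim (absurd _ _ _)
  ∧-not-redundant true  true  false _      = refl
  ∧-not-redundant true  false _     _      = refl
  ∧-not-redundant false _     _     _      = refl

  ∈-removeMiddle : ∀ {A : Set} as {bs} {y z : A} → y ∈ as ++ [ z ] ++ bs → y ≢ z → y ∈ as ++ bs
  ∈-removeMiddle []       (here y≡z) y≢z = contradiction y≡z y≢z
  ∈-removeMiddle []       (there y∈) _   = y∈
  ∈-removeMiddle (a ∷ as) (here y≡a) _   = here y≡a
  ∈-removeMiddle (a ∷ as) (there y∈) y≢z = there (∈-removeMiddle as y∈ y≢z)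

  module _ {A : Set} where

    count-split : ∀ (p q : A → Bool) xs →
      count p xs ≡ count (λ x → p x ∧ q x) xs + count (λ x → p x ∧ not (q x)) xs
    count-split p q [] = refl
    count-split p q (x ∷ xs) with p x | q x
    ... | true  | true  = cong suc (count-split p q xs)
    ... | true  | false = trans (cong suc (count-split p q xs)) (sym (+-suc _ _))
    ... | false | _     = count-split p q xs

    count-cong : ∀ {p q : A → Bool} xs → (∀ {x} → x ∈ xs → p x ≡ q x) → count p xs ≡ count q xs
    count-cong []                _   = refl
    count-cong {p} {q} (x ∷ xs) p≗q with p x | q x | p≗q (here refl)
    ... | true  | true  | _ = cong suc (count-cong xs (λ x∈ → p≗q (there x∈)))
    ... | false | false | _ = count-cong xs (λ x∈ → p≗q (there x∈))

  module _ {A B : Set} where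

    count-map : ∀ (p : B → Bool) (f : A → B) xs → count p (map f xs) ≡ count (p ∘ f) xs
    count-map p f [] = refl
    count-map p f (x ∷ xs) with p (f x)
    ... | true  = cong suc (count-map p f xs)
    ... | false = count-map p f xs

    length-≤-injection : ∀ (φ : A → B) {xs ys} → Unique xs → (∀ {x} → x ∈ xs → φ x ∈ ys) →
      (∀ {x x′} → x ∈ xs → x′ ∈ xs → φ x ≡ φ x′ → x ≡ x′) → length xs ≤ length ys
    length-≤-injection φ {[]} _ _ _ = z≤n
    length-≤-injection φ {x ∷ xs} (x∉xs ∷ xs!) into inj
      with as , bs , refl ← ∈-∃++ (into (here refl)) = begin
        suc (length xs)
          ≤⟨ s≤s (length-≤-injection φ xs! into′ (λ m m′ → inj (there m) (there m′))) ⟩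
        suc (length (as ++ bs))
          ≡⟨ length-++-sucʳ as (φ x) bs ⟨
        length (as ++ [ φ x ] ++ bs) ∎
      where
      open ≤-Reasoning
      into′ : ∀ {x′} → x′ ∈ xs → φ x′ ∈ as ++ bs
      into′ m = ∈-removeMiddle as (into (there m)) λ eq → All.lookup x∉xs m (sym (inj (there m) (here refl) eq))

    count-≤-injection : ∀ {p : A → Bool} {q : B → Bool} (φ : A → B) {xs ys} → Unique xs →
      (∀ {x} → x ∈ xs → T (p x) → φ x ∈ ys × T (q (φ x))) →
      (∀ {x x′} → T (p x) → T (p x′) → φ x ≡ φ x′ → x ≡ x′) →
      count p xs ≤ count q ys
    count-≤-injection {p} {q} φ {xs} {ys} xs! into inj =
      length-≤-injection φ (Unique.filter⁺ (T? ∘ p) xs!) into′ inj′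
      where
      into′ : ∀ {x} → x ∈ filterᵇ p xs → φ x ∈ filterᵇ q ys
      into′ m = let x∈ , px = ∈-filter⁻ (T? ∘ p) m ; φx∈ , qφx = into x∈ px in
        ∈-filter⁺ (T? ∘ q) φx∈ qφx
      inj′ : ∀ {x x′} → x ∈ filterᵇ p xs → x′ ∈ filterᵇ p xs → φ x ≡ φ x′ → x ≡ x′
      inj′ m m′ = inj (proj₂ (∈-filter⁻ (T? ∘ p) {xs = xs} m)) (proj₂ (∈-filter⁻ (T? ∘ p) {xs = xs} m′))

  module _ {A B : Set} (_≟ᴮ_ : DecidableEquality B) where

    sum-count-fibres : ∀ {p : A → Bool} (q : B → A → Bool) xs {L} → Unique L →
      (∀ {x} → x ∈ xs → T (p x) → ∃[ k ] k ∈ L × (∀ y → q y x ≡ ⌊ k ≟ᴮ y ⌋)) →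
      sum (map (λ y → count (λ x → p x ∧ q y x) xs) L) ≡ count p xs
    sum-count-fibres {p} q xs {[]} [] fibre =
      sym (cong length (filter-none (T? ∘ p) (All.tabulate λ x∈ px → case proj₁ (proj₂ (fibre x∈ px)) of λ ())))
    sum-count-fibres {p} q xs {y ∷ L} (y∉L ∷ L!) fibre = begin
      count (λ x → p x ∧ q y x) xs + sum (map (λ y′ → count (λ x → p x ∧ q y′ x) xs) L)
        ≡⟨ cong (λ t → count (λ x → p x ∧ q y x) xs + sum t)
                (map-cong-local (All.tabulate λ y′∈L → count-cong xs (λ x∈ → separate y′∈L x∈))) ⟩
      count (λ x → p x ∧ q y x) xs + sum (map (λ y′ → count (λ x → (p x ∧ not (q y x)) ∧ q y′ x) xs) L)
        ≡⟨ cong (count (λ x → p x ∧ q y x) xs +_) (sum-count-fibres q xs L! fibre′) ⟩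
      count (λ x → p x ∧ q y x) xs + count (λ x → p x ∧ not (q y x)) xs
        ≡⟨ count-split p (q y) xs ⟨
      count p xs ∎
      where
      open ≡-Reasoning
      separate : ∀ {y′ x} → y′ ∈ L → x ∈ xs → p x ∧ q y′ x ≡ (p x ∧ not (q y x)) ∧ q y′ x
      separate {y′} {x} y′∈L x∈ = ∧-not-redundant (p x) (q y x) (q y′ x) λ px qy′x qyx →
        let k , _ , q≡ = fibre x∈ px in
        All.lookup y∉L y′∈L (trans (sym (toWitness (subst T (q≡ y) qyx))) (toWitness (subst T (q≡ y′) qy′x)))
      fibre′ : ∀ {x} → x ∈ xs → T (p x ∧ not (q y x)) →
        ∃[ k ] k ∈ L × (∀ y′ → q y′ x ≡ ⌊ k ≟ᴮ y′ ⌋)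
      fibre′ {x} x∈ t with to (T-∧ {p x}) t
      ... | px , ¬qyx with fibre x∈ px
      ... | k , here refl  , q≡ =
        ⊥-elim (subst (T ∘ not) (trans (q≡ k) (trans (isYes≗does (k ≟ᴮ k)) (dec-true (k ≟ᴮ k) refl))) ¬qyx)
      ... | k , there k∈L , q≡ = k , k∈L , q≡

  module _ {A : Set} (_≟ᴬ_ : DecidableEquality A) where

    open import Data.List.Membership.DecPropositional _≟ᴬ_ using (_∈?_)

    unique-⊆-length⇒⊇ : ∀ {xs ys : List A} → Unique xs → (∀ {x} → x ∈ xs → x ∈ ys) →
      length ys ≤ length xs → ∀ {y} → y ∈ ys → y ∈ xs
    unique-⊆-length⇒⊇ {xs} {ys} xs! xs⊆ys ys≤xs {y} y∈ys with y ∈? xs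
    ... | yes y∈xs = y∈xs
    ... | no  y∉xs = contradiction (≤-trans (length-≤-injection id (y≢xs ∷ xs!) into (λ _ _ → id)) ys≤xs) 1+n≰n
      where
      y≢xs : All (y ≢_) xs
      y≢xs = All.tabulate λ x∈ y≡x → y∉xs (subst (_∈ xs) (sym y≡x) x∈)
      into : ∀ {x} → x ∈ y ∷ xs → x ∈ ys
      into (here refl) = y∈ys
      into (there x∈)  = xs⊆ys x∈

  sum-≤-pointwise : ∀ {X : Set} (a b c : X → ℕ) d xs → (∀ x → a x + b x ≤ c x + d) →
    sum (map a xs) + sum (map b xs) ≤ sum (map c xs) + length xs * d
  sum-≤-pointwise a b c d []       _ = z≤n
  sum-≤-pointwise a b c d (x ∷ xs) h = begin
    (a x + sum (map a xs)) + (b x + sum (map b xs))  ≡⟨ interchange (a x) _ (b x) _ ⟩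
    (a x + b x) + (sum (map a xs) + sum (map b xs))  ≤⟨ +-mono-≤ (h x) (sum-≤-pointwise a b c d xs h) ⟩
    (c x + d) + (sum (map c xs) + length xs * d)     ≡⟨ interchange (c x) d _ _ ⟩
    (c x + sum (map c xs)) + (d + length xs * d)     ∎
    where open ≤-Reasoning

  module _ {X : Set} (s h e : X → ℕ) {c lam : ℕ} (s+h≤e+λ : ∀ z → s z + h z ≤ e z + lam) where

    open ≤-Reasoning

    neighbourhood-bound : ∀ L → sum (map e L) ≡ 2 * c → sum (map h L) ≡ 2 * lam →
      sum (map s L) + 2 * lam ≤ length L * lam + 2 * c
    neighbourhood-bound L Σe Σh = begin
      sum (map s L) + 2 * lam          ≡⟨ cong (sum (map s L) +_) Σh ⟨
      sum (map s L) + sum (map h L)    ≤⟨ sum-≤-pointwise s h e lam L s+h≤e+λ ⟩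
      sum (map e L) + length L * lam   ≡⟨ cong (_+ length L * lam) Σe ⟩
      2 * c + length L * lam           ≡⟨ +-comm (2 * c) _ ⟩
      length L * lam + 2 * c           ∎

    neighbourhood-bound-max : (∀ z → c + h z ≤ e z + lam) →
      ∀ L → sum (map e L) ≡ 2 * c → sum (map h L) ≡ 2 * lam →
      sum (map s L) + 2 * lam ≤ length L * lam + c + foldr _⊔_ 0 (map s L)
    neighbourhood-bound-max _        []       _  Σh = subst (_≤ c + 0) Σh z≤n
    neighbourhood-bound-max c+h≤e+λ (y ∷ ys) Σe Σh = begin
      s y + S + 2 * lam                    ≡⟨ +-assoc (s y) S _ ⟩
      s y + (S + 2 * lam)                  ≤⟨ +-monoʳ-≤ (s y) S+2λ≤ ⟩
      s y + (suc K * lam + c)              ≡⟨ +-comm (s y) _ ⟩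
      suc K * lam + c + s y                ≤⟨ +-monoʳ-≤ (suc K * lam + c) (m≤m⊔n (s y) _) ⟩
      suc K * lam + c + (s y ⊔ foldr _⊔_ 0 (map s ys)) ∎
      where
      S Hs Es K : ℕ
      S  = sum (map s ys)
      Hs = sum (map h ys)
      Es = sum (map e ys)
      K  = length ys
      Es+hy≤c+λ : Es + h y ≤ c + lam
      Es+hy≤c+λ = +-cancelˡ-≤ c _ _ (begin
        c + (Es + h y)      ≡⟨ x∙yz≈y∙xz c Es (h y) ⟩
        Es + (c + h y)      ≤⟨ +-monoʳ-≤ Es (c+h≤e+λ y) ⟩
        Es + (e y + lam)    ≡⟨ +-assoc Es (e y) lam ⟨
        Es + e y + lam      ≡⟨ cong (λ t → t + lam) (trans (+-comm Es (e y)) Σe) ⟩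
        2 * c + lam         ≡⟨ cong (λ t → c + t + lam) (+-identityʳ c) ⟩
        c + c + lam         ≡⟨ +-assoc c c lam ⟩
        c + (c + lam)       ∎)
      S+2λ≤ : S + 2 * lam ≤ suc K * lam + c
      S+2λ≤ = begin
        S + 2 * lam         ≡⟨ cong (S +_) Σh ⟨
        S + (h y + Hs)      ≡⟨ x∙yz≈xz∙y S (h y) Hs ⟩
        S + Hs + h y        ≤⟨ +-monoˡ-≤ (h y) (sum-≤-pointwise s h e lam ys s+h≤e+λ) ⟩
        Es + K * lam + h y  ≡⟨ xy∙z≈xz∙y Es (K * lam) (h y) ⟩
        Es + h y + K * lam  ≤⟨ +-monoˡ-≤ (K * lam) Es+hy≤c+λ ⟩
        c + lam + K * lam   ≡⟨ xy∙z≈yz∙x c lam (K * lam) ⟩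
        suc K * lam + c     ∎

module RootedCycles where

  open import Defs hiding (sym)
  open Counting
  open import Data.Bool using (Bool; true; false; T; _∧_; not)
  open import Data.Bool.Properties using (T-∧; T-≡; ∧-assoc; ∧-comm; ∧-identityʳ; not-involutive)
  open import Data.Empty using (⊥)
  open import Data.Fin using (Fin; toℕ; _≟_)
  open import Data.Fin.Properties using (toℕ-injective)
  open import Data.List using (List; []; _∷_; [_]; _++_; _∷ʳ_; map; length; reverse; _ʳ++_; drop; allFin)
  open import Data.List.Properties
    using (length-map; length-++; length-reverse; map-++; map-∘; map-injective; ++-assoc; ʳ++-defn; reverse-++;
           reverse-map; reverse-involutive; reverse-injective; ∷ʳ-injectiveˡ)
  open import Data.List.Membership.Propositional using (_∈_)
  open import Data.List.Membership.Propositional.Properties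
    using (∈-filter⁺; ∈-filter⁻; ∈-map⁺; ∈-map⁻; ∈-++⁺ʳ; ∈-allFin; ∈-concatMap⁺)
  open import Data.List.Relation.Unary.All as All using (All; []; _∷_)
  import Data.List.Relation.Unary.All.Properties as All
  open import Data.List.Relation.Unary.Any as Any using (here)
  import Data.List.Relation.Unary.AllPairs as AllPairs
  import Data.List.Relation.Unary.AllPairs.Properties as AllPairs
  open import Data.List.Relation.Unary.Unique.Propositional using (Unique; []; _∷_)
  import Data.List.Relation.Unary.Unique.Propositional.Properties as Unique
  open import Data.Nat using (ℕ; zero; suc; _+_; _*_; _∸_; _≤_; _<ᵇ_; _≤ᵇ_; z≤n; s≤s)
  open import Data.Nat.ListAction using (sum)
  open import Data.Nat.Properties
    using (+-comm; +-assoc; +-identityʳ; +-monoˡ-≤; +-monoʳ-≤; *-cancelˡ-≤; *-distribˡ-+; ≤-antisym; ≤-reflexive;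
           ∸-monoˡ-≤; ≤ᵇ⇒≤; ≤⇒≤ᵇ; module ≤-Reasoning)
  open import Data.Product using (∃-syntax; _×_; _,_; proj₁; proj₂)
  open import Data.Vec using (Vec; toList; fromList) renaming ([] to []ᵛ; _∷_ to _∷ᵛ_)
  import Data.Vec.Properties as Vec
  open import Data.Vec.Relation.Binary.Equality.Cast using (cast-is-id)
  open import Function using (_∘_)
  open import Function.Bundles using (Equivalence; mk⇔)
  open import Function.Definitions using (Injective)
  open import Relation.Binary.PropositionalEquality
    using (_≡_; _≢_; refl; sym; trans; cong; cong₂; subst; subst₂; setoid; module ≡-Reasoning)
  open import Relation.Nullary using (¬_; yes; no; contradiction)
  open import Relation.Nullary.Decidable using (⌊_⌋; T?; toWitness; fromWitness; does-⇔; isYes≗does)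

  open Equivalence using (to; from)

  split-first-last : ∀ {A : Set} (l : List A) → 2 ≤ length l → ∃[ a ] ∃[ m ] ∃[ z ] l ≡ a ∷ (m ∷ʳ z)
  split-first-last (a ∷ [])        (s≤s ())
  split-first-last (a ∷ b ∷ [])    _ = a , [] , b , refl
  split-first-last (a ∷ b ∷ c ∷ r) _ =
    let b′ , m , z , eq = split-first-last (b ∷ c ∷ r) (s≤s (s≤s z≤n)) in a , b′ ∷ m , z , cong (a ∷_) eq

  reverse-∷-∷ʳ : ∀ {A : Set} (a : A) m z → reverse (a ∷ (m ∷ʳ z)) ≡ z ∷ (reverse m ∷ʳ a)
  reverse-∷-∷ʳ a m z = trans (ʳ++-defn (m ∷ʳ z)) (cong (_∷ʳ a) (reverse-++ m [ z ]))

  <ᵇ-flip : ∀ x y → x ≢ y → (y <ᵇ x) ≡ not (x <ᵇ y)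
  <ᵇ-flip zero    zero    x≢y = contradiction refl x≢y
  <ᵇ-flip zero    (suc y) _   = refl
  <ᵇ-flip (suc x) zero    _   = refl
  <ᵇ-flip (suc x) (suc y) x≢y = <ᵇ-flip x y (x≢y ∘ cong suc)

  startsAt : ∀ {n} → Fin n → List (Fin n) → Bool
  startsAt y []      = false
  startsAt y (a ∷ _) = ⌊ a ≟ y ⌋

  endsAt : ∀ {n} → Fin n → List (Fin n) → Bool
  endsAt y l = startsAt y (reverse l)

  startsAt⇒≡∷ : ∀ {n} {y : Fin n} l → T (startsAt y l) → ∃[ r ] l ≡ y ∷ r
  startsAt⇒≡∷ {y = y} (a ∷ r) a≟y with toWitness {a? = a ≟ y} a≟y
  ... | refl = r , refl

  module _ {n : ℕ} (G : Graph n) where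

    neighbours-unique : ∀ w → Unique (neighbours G w)
    neighbours-unique w = Unique.filter⁺ (T? ∘ adj G w) (Unique.allFin⁺ n)

    ∈-neighbours⁺ : ∀ {w y} → T (adj G w y) → y ∈ neighbours G w
    ∈-neighbours⁺ {w} {y} = ∈-filter⁺ (T? ∘ adj G w) (∈-allFin y)

    ∈-neighbours⁻ : ∀ {w y} → y ∈ neighbours G w → T (adj G w y)
    ∈-neighbours⁻ {w} y∈ = proj₂ (∈-filter⁻ (T? ∘ adj G w) {xs = allFin n} y∈)

    allVecs-complete : ∀ m (t : Vec (Fin n) m) → t ∈ allVecs G m
    allVecs-complete zero    []ᵛ       = here refl
    allVecs-complete (suc m) (x ∷ᵛ t) =
      ∈-concatMap⁺ _ (Any.map (λ { refl → ∈-map⁺ (x ∷ᵛ_) (allVecs-complete m t) }) (∈-allFin x))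

    allVecs-unique : ∀ m → Unique (allVecs G m)
    allVecs-unique zero    = [] ∷ []
    allVecs-unique (suc m) =
      Unique.concat⁺ (All.map⁺ (All.tabulate λ _ → Unique.map⁺ Vec.∷-injectiveʳ (allVecs-unique m)))
                     (AllPairs.map⁺ (AllPairs.map disjoint (Unique.allFin⁺ n)))
      where
      disjoint : ∀ {x y} → x ≢ y → ∀ {t} →
        ¬ (t ∈ map (x ∷ᵛ_) (allVecs G m) × t ∈ map (y ∷ᵛ_) (allVecs G m))
      disjoint x≢y (t∈x , t∈y) with ∈-map⁻ _ t∈x | ∈-map⁻ _ t∈y
      ... | _ , _ , refl | _ , _ , eq = x≢y (Vec.∷-injectiveˡ eq)

    pathAdj-++ : ∀ xs y ys → pathAdj G (xs ++ y ∷ ys) ≡ pathAdj G (xs ∷ʳ y) ∧ pathAdj G (y ∷ ys)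
    pathAdj-++ []            y ys = refl
    pathAdj-++ (x ∷ [])      y ys = cong (_∧ pathAdj G (y ∷ ys)) (sym (∧-identityʳ (adj G x y)))
    pathAdj-++ (x ∷ x′ ∷ xs) y ys =
      trans (cong (adj G x x′ ∧_) (pathAdj-++ (x′ ∷ xs) y ys)) (sym (∧-assoc (adj G x x′) _ _))

    pathAdj-reverse : ∀ p → pathAdj G (reverse p) ≡ pathAdj G p
    pathAdj-reverse []          = refl
    pathAdj-reverse (x ∷ [])    = refl
    pathAdj-reverse (x ∷ y ∷ r) = begin
      pathAdj G (r ʳ++ y ∷ [ x ])                       ≡⟨ cong (pathAdj G) (ʳ++-defn r) ⟩
      pathAdj G (reverse r ++ y ∷ [ x ])                ≡⟨ pathAdj-++ (reverse r) y [ x ] ⟩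
      pathAdj G (reverse r ∷ʳ y) ∧ (adj G y x ∧ true)   ≡⟨ cong (pathAdj G (reverse r ∷ʳ y) ∧_) (∧-identityʳ _) ⟩
      pathAdj G (reverse r ∷ʳ y) ∧ adj G y x            ≡⟨ cong (λ b → pathAdj G b ∧ adj G y x) (ʳ++-defn r) ⟨
      pathAdj G (reverse (y ∷ r)) ∧ adj G y x           ≡⟨ cong (_∧ adj G y x) (pathAdj-reverse (y ∷ r)) ⟩
      pathAdj G (y ∷ r) ∧ adj G y x                     ≡⟨ ∧-comm (pathAdj G (y ∷ r)) _ ⟩
      adj G y x ∧ pathAdj G (y ∷ r)                     ≡⟨ cong (_∧ pathAdj G (y ∷ r)) (Graph.sym G y x) ⟩
      adj G x y ∧ pathAdj G (y ∷ r)                     ∎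
      where open ≡-Reasoning

    closedAdj-reverse : ∀ w l → closedAdj G (w ∷ reverse l) ≡ closedAdj G (w ∷ l)
    closedAdj-reverse w l =
      trans (cong (pathAdj G) (sym (reverse-∷-∷ʳ w l w))) (pathAdj-reverse (w ∷ (l ∷ʳ w)))

    closedAdj-rotate : ∀ w y r → closedAdj G (y ∷ (r ∷ʳ w)) ≡ closedAdj G (w ∷ y ∷ r)
    closedAdj-rotate w y r = begin
      pathAdj G ((y ∷ (r ∷ʳ w)) ∷ʳ y)                 ≡⟨ cong (pathAdj G) (++-assoc (y ∷ r) [ w ] [ y ]) ⟩
      pathAdj G ((y ∷ r) ++ w ∷ [ y ])                ≡⟨ pathAdj-++ (y ∷ r) w [ y ] ⟩
      pathAdj G (y ∷ (r ∷ʳ w)) ∧ (adj G w y ∧ true)   ≡⟨ cong (pathAdj G (y ∷ (r ∷ʳ w)) ∧_) (∧-identityʳ _) ⟩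
      pathAdj G (y ∷ (r ∷ʳ w)) ∧ adj G w y            ≡⟨ ∧-comm (pathAdj G (y ∷ (r ∷ʳ w))) _ ⟩
      adj G w y ∧ pathAdj G (y ∷ (r ∷ʳ w))            ∎
      where open ≡-Reasoning

    closedAdj⇒adj : ∀ {w a r} → T (closedAdj G (w ∷ a ∷ r)) → T (adj G w a)
    closedAdj⇒adj {w} {a} closed = proj₁ (to (T-∧ {adj G w a}) closed)

    lastOr-∷ʳ : ∀ d m (z : Fin n) → lastOr G d (m ∷ʳ z) ≡ z
    lastOr-∷ʳ d []      z = refl
    lastOr-∷ʳ d (x ∷ m) z = lastOr-∷ʳ x m z

    ¬elem⇒≢ : ∀ {x} r → T (not (elem G x r)) → All (x ≢_) r
    ¬elem⇒≢         []      _ = []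
    ¬elem⇒≢ {x} (y ∷ r) x∉ with x ≟ y
    ... | no x≢y = x≢y ∷ ¬elem⇒≢ r x∉

    ≢⇒¬elem : ∀ {x r} → All (x ≢_) r → T (not (elem G x r))
    ≢⇒¬elem                []            = _
    ≢⇒¬elem {x} {y ∷ r} (x≢y ∷ x≢r) with x ≟ y
    ... | yes x≡y = x≢y x≡y
    ... | no  _   = ≢⇒¬elem x≢r

    distinct⇒Unique : ∀ l → T (distinct G l) → Unique l
    distinct⇒Unique []      _ = []
    distinct⇒Unique (x ∷ r) d =
      let x∉r , r! = to (T-∧ {not (elem G x r)}) d in ¬elem⇒≢ r x∉r ∷ distinct⇒Unique r r!

    Unique⇒distinct : ∀ {l} → Unique l → T (distinct G l)
    Unique⇒distinct []          = _
    Unique⇒distinct (x∉r ∷ r!) = from T-∧ (≢⇒¬elem x∉r , Unique⇒distinct r!)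

  module _ {n : ℕ} (G : Graph n) (g : ℕ) where

    walks : List (List (Fin n))
    walks = map toList (allVecs G (g ∸ 1))

    #walks : (List (Fin n) → Bool) → ℕ
    #walks p = count p walks

    walks-unique : Unique walks
    walks-unique = Unique.map⁺ (λ {s} {t} eq → trans (sym (cast-is-id refl s)) (Vec.toList-injective refl s t eq))
                               (allVecs-unique G (g ∸ 1))

    ∈-walks⁻ : ∀ {l} → l ∈ walks → length l ≡ g ∸ 1
    ∈-walks⁻ l∈ with t , _ , refl ← ∈-map⁻ toList l∈ = Vec.length-toList t

    ∈-walks⁺ : ∀ {l} → length l ≡ g ∸ 1 → l ∈ walks
    ∈-walks⁺ {l} len = subst (λ k → l ∈ map toList (allVecs G k)) len
      (subst (_∈ map toList (allVecs G (length l))) (Vec.toList∘fromList l)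
             (∈-map⁺ toList (allVecs-complete G _ (fromList l))))

    isCycleAt : Fin n → List (Fin n) → Bool
    isCycleAt w l = (3 ≤ᵇ g) ∧ distinct G (w ∷ l) ∧ closedAdj G (w ∷ l)

    record IsCycleAt (w : Fin n) (l : List (Fin n)) : Set where
      field
        length≡ : length l ≡ g ∸ 1
        3≤g     : 3 ≤ g
        unique  : Unique (w ∷ l)
        closed  : T (closedAdj G (w ∷ l))

    isCycleAt⇒IsCycleAt : ∀ {w l} → l ∈ walks → T (isCycleAt w l) → IsCycleAt w l
    isCycleAt⇒IsCycleAt {w} {l} l∈ t =
      let 3≤ᵇg , t′ = to (T-∧ {3 ≤ᵇ g}) t ; d , c = to (T-∧ {distinct G (w ∷ l)}) t′ in
      record
        { length≡ = ∈-walks⁻ l∈ ; 3≤g = ≤ᵇ⇒≤ 3 g 3≤ᵇg ; unique = distinct⇒Unique G (w ∷ l) d ; closed = c }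

    IsCycleAt⇒isCycleAt : ∀ {w l} → IsCycleAt w l → l ∈ walks × T (isCycleAt w l)
    IsCycleAt⇒isCycleAt c = ∈-walks⁺ (IsCycleAt.length≡ c) ,
      from T-∧ (≤⇒≤ᵇ (IsCycleAt.3≤g c) , from T-∧ (Unique⇒distinct G (IsCycleAt.unique c) , IsCycleAt.closed c))

    cyc≡#walks : ∀ w → cyc G g w ≡ #walks (λ l → isCycleAt w l ∧ canonical G l)
    cyc≡#walks w = trans
      (count-cong (allVecs G (g ∸ 1)) λ {t} _ →
        reassociate (3 ≤ᵇ g) (distinct G (w ∷ toList t)) (closedAdj G (w ∷ toList t)) (canonical G (toList t)))
      (sym (count-map (λ l → isCycleAt w l ∧ canonical G l) toList (allVecs G (g ∸ 1))))
      where
      reassociate : ∀ a b c d → a ∧ b ∧ c ∧ d ≡ (a ∧ b ∧ c) ∧ d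
      reassociate a b c d = sym (trans (∧-assoc a (b ∧ c) d) (cong (a ∧_) (∧-assoc b c d)))

    cycle-ends : ∀ {w l} → IsCycleAt w l → ∃[ a ] ∃[ m ] ∃[ z ] l ≡ a ∷ (m ∷ʳ z) × a ≢ z
    cycle-ends {l = l} c
      with split-first-last l (subst (2 ≤_) (sym (IsCycleAt.length≡ c)) (∸-monoˡ-≤ 1 (IsCycleAt.3≤g c)))
    ... | a , m , z , refl with IsCycleAt.unique c
    ...   | _ ∷ (a∉ ∷ _) = a , m , z , refl , All.lookup a∉ (∈-++⁺ʳ m (here refl))

    IsCycleAt-reverse : ∀ {w l} → IsCycleAt w l → IsCycleAt w (reverse l)
    IsCycleAt-reverse {w} {l} c = record
      { length≡ = trans (length-reverse l) (IsCycleAt.length≡ c)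
      ; 3≤g     = IsCycleAt.3≤g c
      ; unique  = Unique-resp-↭ (↭-prep w (↭-sym (↭-reverse l))) (IsCycleAt.unique c)
      ; closed  = subst T (sym (closedAdj-reverse G w l)) (IsCycleAt.closed c)
      }
      where
      open import Data.List.Relation.Binary.Permutation.Setoid (setoid (Fin n)) using (↭-prep; ↭-sym)
      open import Data.List.Relation.Binary.Permutation.Setoid.Properties (setoid (Fin n)) using (Unique-resp-↭; ↭-reverse)

    IsCycleAt-rotate : ∀ {w y r} → IsCycleAt w (y ∷ r) → IsCycleAt y (r ∷ʳ w)
    IsCycleAt-rotate {w} {y} {r} c = record
      { length≡ = trans (trans (length-++ r) (+-comm (length r) 1)) (IsCycleAt.length≡ c)
      ; 3≤g     = IsCycleAt.3≤g c
      ; unique  = Unique-resp-↭ (∷↭∷ʳ w (y ∷ r)) (IsCycleAt.unique c)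
      ; closed  = subst T (sym (closedAdj-rotate G w y r)) (IsCycleAt.closed c)
      }
      where
      open import Data.List.Relation.Binary.Permutation.Setoid.Properties (setoid (Fin n)) using (Unique-resp-↭; ∷↭∷ʳ)

    canonical-reverse : ∀ {w l} → IsCycleAt w l → canonical G (reverse l) ≡ not (canonical G l)
    canonical-reverse c with cycle-ends c
    ... | a , m , z , refl , a≢z = begin
      canonical G (reverse (a ∷ (m ∷ʳ z)))        ≡⟨ cong (canonical G) (reverse-∷-∷ʳ a m z) ⟩
      toℕ z <ᵇ toℕ (lastOr G z (reverse m ∷ʳ a))  ≡⟨ cong (λ x → toℕ z <ᵇ toℕ x) (lastOr-∷ʳ G z (reverse m) a) ⟩
      toℕ z <ᵇ toℕ a                              ≡⟨ <ᵇ-flip (toℕ a) (toℕ z) (a≢z ∘ toℕ-injective) ⟩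
      not (toℕ a <ᵇ toℕ z)                        ≡⟨ cong (λ x → not (toℕ a <ᵇ toℕ x)) (lastOr-∷ʳ G a m z) ⟨
      not (canonical G (a ∷ (m ∷ʳ z)))            ∎
      where open ≡-Reasoning

    endsAt⇒¬startsAt : ∀ {w l y} → IsCycleAt w l → T (endsAt y l) → T (startsAt y l) → ⊥
    endsAt⇒¬startsAt {y = y} c ends starts with cycle-ends c
    ... | a , m , z , refl , a≢z = a≢z (trans (toWitness starts) (sym (toWitness ends′)))
      where
      ends′ : T (startsAt y (z ∷ (reverse m ∷ʳ a)))
      ends′ = subst (T ∘ startsAt y) (reverse-∷-∷ʳ a m z) ends

  module _ {n n′ : ℕ} {G : Graph n} {G′ : Graph n′} {g : ℕ} where

    cycles-≤ : ∀ {w w′} {p : List (Fin n) → Bool} {q : List (Fin n′) → Bool}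
      (φ : List (Fin n) → List (Fin n′)) →
      (∀ {l} → IsCycleAt G g w l → T (p l) → IsCycleAt G′ g w′ (φ l) × T (q (φ l))) →
      (∀ {l l′} → T (p l) → T (p l′) → φ l ≡ φ l′ → l ≡ l′) →
      #walks G g (λ l → isCycleAt G g w l ∧ p l) ≤ #walks G′ g (λ l → isCycleAt G′ g w′ l ∧ q l)
    cycles-≤ {w} {w′} {p} {q} φ into inj = count-≤-injection φ (walks-unique G g) into′ inj′
      where
      into′ : ∀ {l} → l ∈ walks G g → T (isCycleAt G g w l ∧ p l) →
        φ l ∈ walks G′ g × T (isCycleAt G′ g w′ (φ l) ∧ q (φ l))
      into′ {l} l∈ t =
        let cl , pl = to (T-∧ {isCycleAt G g w l}) t
            c′ , qφl = into (isCycleAt⇒IsCycleAt G g l∈ cl) pl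
            φl∈ , cφl = IsCycleAt⇒isCycleAt G′ g c′
        in φl∈ , from T-∧ (cφl , qφl)
      inj′ : ∀ {l l′} → T (isCycleAt G g w l ∧ p l) → T (isCycleAt G g w l′ ∧ p l′) → φ l ≡ φ l′ → l ≡ l′
      inj′ {l} {l′} t t′ =
        inj (proj₂ (to (T-∧ {isCycleAt G g w l}) t)) (proj₂ (to (T-∧ {isCycleAt G g w l′}) t′))

  module _ {n : ℕ} (G : Graph n) (g : ℕ) where

    rooted : Fin n → ℕ
    rooted w = #walks G g (isCycleAt G g w)

    -- The g-cycles through the edge wy, each counted once: in its orientation starting w, y.
    leaving : Fin n → Fin n → ℕ
    leaving w y = #walks G g (λ l → isCycleAt G g w l ∧ startsAt y l)

    avoiding : Fin n → Fin n → ℕ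
    avoiding w y = #walks G g (λ l → isCycleAt G g w l ∧ not (startsAt y l) ∧ not (endsAt y l))

    #cycles-cong : ∀ {w} {p q : List (Fin n) → Bool} → (∀ {l} → IsCycleAt G g w l → p l ≡ q l) →
      #walks G g (λ l → isCycleAt G g w l ∧ p l) ≡ #walks G g (λ l → isCycleAt G g w l ∧ q l)
    #cycles-cong p≡q = count-cong (walks G g) λ l∈ → ∧-congˡ-T λ t → p≡q (isCycleAt⇒IsCycleAt G g l∈ t)

    #cycles-reverse : ∀ w (p : List (Fin n) → Bool) →
      #walks G g (λ l → isCycleAt G g w l ∧ p l) ≡ #walks G g (λ l → isCycleAt G g w l ∧ p (reverse l))
    #cycles-reverse w p = ≤-antisym
      (cycles-≤ reverse (λ c pl → IsCycleAt-reverse G g c , subst (T ∘ p) (sym (reverse-involutive _)) pl)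
                        (λ _ _ → reverse-injective))
      (cycles-≤ reverse (λ c pl → IsCycleAt-reverse G g c , pl) (λ _ _ → reverse-injective))

    rooted≡2*cyc : ∀ w → rooted w ≡ 2 * cyc G g w
    rooted≡2*cyc w = begin
      rooted w                                    ≡⟨ count-split (isCycleAt G g w) (canonical G) (walks G g) ⟩
      #canonical + #walks G g (λ l → isCycleAt G g w l ∧ not (canonical G l))
                                                  ≡⟨ cong (#canonical +_) #non-canonical ⟩
      #canonical + #canonical                     ≡⟨ cong (λ k → k + k) (cyc≡#walks G g w) ⟨
      cyc G g w + cyc G g w                       ≡⟨ cong (cyc G g w +_) (+-identityʳ _) ⟨
      2 * cyc G g w                               ∎
      where
      open ≡-Reasoning
      #canonical : ℕ
      #canonical = #walks G g (λ l → isCycleAt G g w l ∧ canonical G l)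
      #non-canonical : #walks G g (λ l → isCycleAt G g w l ∧ not (canonical G l)) ≡ #canonical
      #non-canonical = trans (#cycles-reverse w (not ∘ canonical G))
        (#cycles-cong λ c → trans (cong not (canonical-reverse G g c)) (not-involutive _))

    rooted≡2*leaving+avoiding : ∀ w y → rooted w ≡ 2 * leaving w y + avoiding w y
    rooted≡2*leaving+avoiding w y = begin
      rooted w                                     ≡⟨ count-split C (startsAt y) (walks G g) ⟩
      leaving w y + #walks G g C∧¬s                ≡⟨ cong (leaving w y +_) (count-split C∧¬s (endsAt y) (walks G g)) ⟩
      leaving w y + (#walks G g (λ l → C∧¬s l ∧ endsAt y l) + #walks G g (λ l → C∧¬s l ∧ not (endsAt y l)))
                                                   ≡⟨ cong₂ (λ a b → leaving w y + (a + b)) #ends #avoiding ⟩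
      leaving w y + (leaving w y + avoiding w y)   ≡⟨ +-assoc (leaving w y) _ _ ⟨
      leaving w y + leaving w y + avoiding w y     ≡⟨ cong (λ k → leaving w y + k + avoiding w y) (+-identityʳ _) ⟨
      2 * leaving w y + avoiding w y               ∎
      where
      open ≡-Reasoning
      C C∧¬s : List (Fin n) → Bool
      C = isCycleAt G g w
      C∧¬s l = C l ∧ not (startsAt y l)
      #ends : #walks G g (λ l → C∧¬s l ∧ endsAt y l) ≡ leaving w y
      #ends = trans (count-cong (walks G g) λ {l} l∈ → sym (∧-not-redundant (C l) (startsAt y l) (endsAt y l)
                      λ t → endsAt⇒¬startsAt G g (isCycleAt⇒IsCycleAt G g l∈ t)))
                    (sym (#cycles-reverse w (startsAt y)))
      #avoiding : #walks G g (λ l → C∧¬s l ∧ not (endsAt y l)) ≡ avoiding w y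
      #avoiding = count-cong (walks G g) λ {l} _ → ∧-assoc (C l) _ _

    leaving-≤ : ∀ w y → leaving w y ≤ leaving y w
    leaving-≤ w y = begin
      leaving w y                                        ≤⟨ cycles-≤ (λ l → drop 1 l ∷ʳ w) rotate injective ⟩
      #walks G g (λ l → isCycleAt G g y l ∧ endsAt w l)  ≡⟨ #cycles-reverse y (startsAt w) ⟨
      leaving y w                                        ∎
      where
      open ≤-Reasoning
      rotate : ∀ {l} → IsCycleAt G g w l → T (startsAt y l) →
        IsCycleAt G g y (drop 1 l ∷ʳ w) × T (endsAt w (drop 1 l ∷ʳ w))
      rotate {l} c s with startsAt⇒≡∷ l s
      ... | r , refl = IsCycleAt-rotate G g c ,
                       subst (T ∘ startsAt w) (sym (reverse-++ r [ w ])) (fromWitness {a? = w ≟ w} refl)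
      injective : ∀ {l l′} → T (startsAt y l) → T (startsAt y l′) → drop 1 l ∷ʳ w ≡ drop 1 l′ ∷ʳ w → l ≡ l′
      injective {l} {l′} s s′ eq with startsAt⇒≡∷ l s | startsAt⇒≡∷ l′ s′
      ... | r , refl | r′ , refl = cong (y ∷_) (∷ʳ-injectiveˡ r r′ eq)

    leaving-sym : ∀ w y → leaving w y ≡ leaving y w
    leaving-sym w y = ≤-antisym (leaving-≤ w y) (leaving-≤ y w)

    sum-leaving : ∀ w {L} → Unique L → (∀ {y} → T (adj G w y) → y ∈ L) → sum (map (leaving w) L) ≡ rooted w
    sum-leaving w {L} L! covers = sum-count-fibres _≟_ startsAt (walks G g) L! first-step
      where
      first-step : ∀ {l} → l ∈ walks G g → T (isCycleAt G g w l) →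
        ∃[ k ] k ∈ L × (∀ y → startsAt y l ≡ ⌊ k ≟ y ⌋)
      first-step l∈ t with isCycleAt⇒IsCycleAt G g l∈ t
      ... | c with cycle-ends G g c
      ... | a , m , z , refl , _ = a , covers (closedAdj⇒adj G {r = m ∷ʳ z} (IsCycleAt.closed c)) , λ _ → refl

  module Embedding {m v : ℕ} {G : Graph m} {H : Graph v} (g : ℕ) (f : Fin m → Fin v)
    (f-injective : Injective _≡_ _≡_ f) (f-adj : ∀ x y → adj G x y ≡ true → adj H (f x) (f y) ≡ true) where

    adj-map : ∀ {x y} → T (adj G x y) → T (adj H (f x) (f y))
    adj-map {x} {y} xy = from T-≡ (f-adj x y (to (T-≡ {adj G x y}) xy))

    pathAdj-map : ∀ p → T (pathAdj G p) → T (pathAdj H (map f p))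
    pathAdj-map []          _    = _
    pathAdj-map (x ∷ [])    _    = _
    pathAdj-map (x ∷ y ∷ r) path =
      let xy , rest = to (T-∧ {adj G x y}) path in from T-∧ (adj-map xy , pathAdj-map (y ∷ r) rest)

    IsCycleAt-map : ∀ {w l} → IsCycleAt G g w l → IsCycleAt H g (f w) (map f l)
    IsCycleAt-map {w} {l} c = record
      { length≡ = trans (length-map f l) (IsCycleAt.length≡ c)
      ; 3≤g     = IsCycleAt.3≤g c
      ; unique  = Unique.map⁺ f-injective (IsCycleAt.unique c)
      ; closed  = subst (T ∘ pathAdj H) (map-++ f (w ∷ l) [ w ]) (pathAdj-map (w ∷ (l ∷ʳ w)) (IsCycleAt.closed c))
      }

    startsAt-map : ∀ y l → startsAt (f y) (map f l) ≡ startsAt y l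
    startsAt-map y []      = refl
    startsAt-map y (a ∷ _) = trans (isYes≗does (f a ≟ f y))
      (trans (does-⇔ (mk⇔ f-injective (cong f)) (f a ≟ f y) (a ≟ y)) (sym (isYes≗does (a ≟ y))))

    endsAt-map : ∀ y l → endsAt (f y) (map f l) ≡ endsAt y l
    endsAt-map y l = trans (cong (startsAt (f y)) (sym (reverse-map f l))) (startsAt-map y (reverse l))

    avoiding-≤ : ∀ z y → avoiding G g z y ≤ avoiding H g (f z) (f y)
    avoiding-≤ z y = cycles-≤ (map f) (λ {l} c t → IsCycleAt-map c , subst T (sym (avoids-map l)) t)
                                       (λ _ _ → map-injective f-injective)
      where
      avoids-map : ∀ l → not (startsAt (f y) (map f l)) ∧ not (endsAt (f y) (map f l))
                       ≡ not (startsAt y l) ∧ not (endsAt y l)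
      avoids-map l = cong₂ (λ s e → not s ∧ not e) (startsAt-map y l) (endsAt-map y l)

    cyc+leaving≤leaving+cyc : ∀ z y → cyc G g z + leaving H g (f z) (f y) ≤ leaving G g z y + cyc H g (f z)
    cyc+leaving≤leaving+cyc z y = *-cancelˡ-≤ 2 (begin
      2 * (cyc G g z + lH)             ≡⟨ *-distribˡ-+ 2 (cyc G g z) lH ⟩
      2 * cyc G g z + 2 * lH           ≡⟨ cong (_+ 2 * lH) splitG ⟩
      2 * lG + aG + 2 * lH             ≤⟨ +-monoˡ-≤ (2 * lH) (+-monoʳ-≤ (2 * lG) (avoiding-≤ z y)) ⟩
      2 * lG + aH + 2 * lH             ≡⟨ +-assoc (2 * lG) aH _ ⟩
      2 * lG + (aH + 2 * lH)           ≡⟨ cong (2 * lG +_) (+-comm aH _) ⟩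
      2 * lG + (2 * lH + aH)           ≡⟨ cong (2 * lG +_) splitH ⟩
      2 * lG + 2 * cyc H g (f z)       ≡⟨ *-distribˡ-+ 2 lG (cyc H g (f z)) ⟨
      2 * (lG + cyc H g (f z))         ∎)
      where
      open ≤-Reasoning
      lG lH aG aH : ℕ
      lG = leaving G g z y
      lH = leaving H g (f z) (f y)
      aG = avoiding G g z y
      aH = avoiding H g (f z) (f y)
      splitG : 2 * cyc G g z ≡ 2 * lG + aG
      splitG = trans (sym (rooted≡2*cyc G g z)) (rooted≡2*leaving+avoiding G g z y)
      splitH : 2 * lH + aH ≡ 2 * cyc H g (f z)
      splitH = trans (sym (rooted≡2*leaving+avoiding H g (f z) (f y))) (rooted≡2*cyc H g (f z))

    image-covers-neighbours : ∀ u → deg G u ≡ deg H (f u) →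
      ∀ {y} → T (adj H (f u) y) → y ∈ map f (neighbours G u)
    image-covers-neighbours u deg≡ fu~y =
      unique-⊆-length⇒⊇ _≟_ (Unique.map⁺ f-injective (neighbours-unique G u)) into
        (≤-reflexive (trans (sym deg≡) (sym (length-map f (neighbours G u))))) (∈-neighbours⁺ H fu~y)
      where
      into : ∀ {y} → y ∈ map f (neighbours G u) → y ∈ neighbours H (f u)
      into y∈ with _ , z∈ , refl ← ∈-map⁻ f y∈ = ∈-neighbours⁺ H (adj-map (∈-neighbours⁻ G z∈))

    neighbourhood-inequalities : ∀ u {k lam} → deg G u ≡ k → Regular H k → (∀ x → cyc H g x ≡ lam) →
      sumNbrCyc G g u + 2 * lam ≤ k * lam + 2 * cyc G g u ×
      sumNbrCyc G g u + 2 * lam ≤ k * lam + cyc G g u + maxNbrCyc G g u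
    neighbourhood-inequalities u {k} {lam} deg≡k regular cyc≡λ =
      subst (λ K → _ ≤ K * lam + _) deg≡k (neighbourhood-bound (cyc G g) h e {cyc G g u} s+h≤e+λ N Σe Σh) ,
      subst (λ K → _ ≤ K * lam + _ + _) deg≡k
        (neighbourhood-bound-max (cyc G g) h e {cyc G g u} s+h≤e+λ c+h≤e+λ N Σe Σh)
      where
      open ≡-Reasoning
      N : List (Fin m)
      N = neighbours G u
      e h : Fin m → ℕ
      e = leaving G g u
      h z = leaving H g (f u) (f z)
      s+h≤e+λ : ∀ z → cyc G g z + h z ≤ e z + lam
      s+h≤e+λ z = subst₂ (λ a b → cyc G g z + a ≤ b + lam) (leaving-sym H g (f z) (f u)) (leaving-sym G g z u)
        (subst (λ t → cyc G g z + leaving H g (f z) (f u) ≤ leaving G g z u + t) (cyc≡λ (f z))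
               (cyc+leaving≤leaving+cyc z u))
      c+h≤e+λ : ∀ y → cyc G g u + h y ≤ e y + lam
      c+h≤e+λ y = subst (λ t → cyc G g u + h y ≤ e y + t) (cyc≡λ (f u)) (cyc+leaving≤leaving+cyc u y)
      Σe : sum (map e N) ≡ 2 * cyc G g u
      Σe = trans (sum-leaving G g u (neighbours-unique G u) (∈-neighbours⁺ G)) (rooted≡2*cyc G g u)
      Σh : sum (map h N) ≡ 2 * lam
      Σh = begin
        sum (map h N)                            ≡⟨ cong sum (map-∘ N) ⟩
        sum (map (leaving H g (f u)) (map f N))  ≡⟨ sum-leaving H g (f u) (Unique.map⁺ f-injective (neighbours-unique G u))
                                                      (image-covers-neighbours u (trans deg≡k (sym (regular (f u))))) ⟩
        rooted H g (f u)                         ≡⟨ rooted≡2*cyc H g (f u) ⟩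
        2 * cyc H g (f u)                        ≡⟨ cong (2 *_) (cyc≡λ (f u)) ⟩
        2 * lam                                  ∎

open import Defs
open import Data.Nat using (ℕ)
open import Data.Fin using (Fin)
open import Data.Integer using (ℤ; +_; _+_; _-_; _*_; _<_; _≤_)
open import Data.Product using (_×_)
open import Data.Sum using (_⊎_)
open import Relation.Binary.PropositionalEquality using (_≡_)
open import Relation.Nullary using (¬_)

import Data.Nat as ℕ
open import Data.Integer using (+≤+)
open import Data.Integer.Properties using (pos-+; pos-*; ≤⇒≯; i≤j⇒0≤j-i)
import Data.Integer.Tactic.RingSolver as ℤ-Solver
open import Data.Product using (_,_; proj₂)
open import Data.Sum using ([_,_])
open import Function using (_∘_)
open import Relation.Binary.PropositionalEquality using (refl; trans; cong; cong₂; module ≡-Reasoning)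
open RootedCycles using (module Embedding)

≤⇒¬<0 : ∀ {a b : ℕ} {e : ℤ} → a ℕ.≤ b → e ≡ + b - + a → ¬ e < + 0
≤⇒¬<0 a≤b refl = ≤⇒≯ (i≤j⇒0≤j-i (+≤+ a≤b))

+[s+2l] : ∀ s l → + (s ℕ.+ 2 ℕ.* l) ≡ + s + + 2 * + l
+[s+2l] s l = trans (pos-+ s _) (cong (λ i → + s + i) (pos-* 2 l))

lhs₁≡difference : ∀ k l c s →
  (+ k - + 2) * + l + + 2 * + c - + s ≡ + (k ℕ.* l ℕ.+ 2 ℕ.* c) - + (s ℕ.+ 2 ℕ.* l)
lhs₁≡difference k l c s = begin
  (+ k - + 2) * + l + + 2 * + c - + s           ≡⟨ rearrange (+ k) (+ l) (+ c) (+ s) ⟩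
  (+ k * + l + + 2 * + c) - (+ s + + 2 * + l)   ≡⟨ cong₂ _-_ +[kl+2c] (+[s+2l] s l) ⟨
  + (k ℕ.* l ℕ.+ 2 ℕ.* c) - + (s ℕ.+ 2 ℕ.* l)   ∎
  where
  open ≡-Reasoning
  rearrange : ∀ (k l c s : ℤ) → (k - + 2) * l + + 2 * c - s ≡ (k * l + + 2 * c) - (s + + 2 * l)
  rearrange = ℤ-Solver.solve-∀
  +[kl+2c] : + (k ℕ.* l ℕ.+ 2 ℕ.* c) ≡ + k * + l + + 2 * + c
  +[kl+2c] = trans (pos-+ (k ℕ.* l) _) (cong₂ _+_ (pos-* k l) (pos-* 2 c))

lhs₂≡difference : ∀ k l c s M →
  (+ k - + 2) * + l + + c - + s + + M ≡ + (k ℕ.* l ℕ.+ c ℕ.+ M) - + (s ℕ.+ 2 ℕ.* l)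
lhs₂≡difference k l c s M = begin
  (+ k - + 2) * + l + + c - + s + + M           ≡⟨ rearrange (+ k) (+ l) (+ c) (+ s) (+ M) ⟩
  (+ k * + l + + c + + M) - (+ s + + 2 * + l)   ≡⟨ cong₂ _-_ +[kl+c+M] (+[s+2l] s l) ⟨
  + (k ℕ.* l ℕ.+ c ℕ.+ M) - + (s ℕ.+ 2 ℕ.* l)   ∎
  where
  open ≡-Reasoning
  rearrange : ∀ (k l c s M : ℤ) → (k - + 2) * l + c - s + M ≡ (k * l + c + M) - (s + + 2 * l)
  rearrange = ℤ-Solver.solve-∀
  +[kl+c+M] : + (k ℕ.* l ℕ.+ c ℕ.+ M) ≡ + k * + l + + c + + M
  +[kl+c+M] = trans (pos-+ (k ℕ.* l ℕ.+ c) M)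
    (cong (λ i → i + + M) (trans (pos-+ (k ℕ.* l) c) (cong (λ i → i + + c) (pos-* k l))))

proposition3 : ∀ {m} (G : Graph m) (g k lam : ℕ) (u : Fin m) →
    deg G u ≡ k →
    ((((+ k - + 2) * + lam) + (+ 2 * + cyc G g u) - + sumNbrCyc G g u) < + 0
      ⊎ (((+ 0 ≤ ((+ 2 - + k) * + lam) + + sumNbrCyc G g u - (+ 2 * + maxNbrCyc G g u))
        × ((((+ k - + 2) * + lam) + + cyc G g u - + sumNbrCyc G g u + + maxNbrCyc G g u) < + 0)))) →
    ∀ (v : ℕ) (H : Graph v) → IsVGR v k g lam H → ¬ SubgraphOf G H
proposition3 G g k lam u deg≡k condition v H (regular , _ , cyc≡λ) (f , f-injective , f-adj) =
  let first , second = Embedding.neighbourhood-inequalities g f f-injective f-adj u deg≡k regular cyc≡λ in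
  [ ≤⇒¬<0 first (lhs₁≡difference k lam (cyc G g u) (sumNbrCyc G g u))
  , ≤⇒¬<0 second (lhs₂≡difference k lam (cyc G g u) (sumNbrCyc G g u) (maxNbrCyc G g u)) ∘ proj₂
  ] condition
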